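{- Over an alphabet with as many characters as needed, the self-referencing LZ77 factorization size satisfies $\mathsf{AS}_{\mathrm{sub}}(\mathit{z}_{77sr},n)=\Omega(\sqrt n)$, $\mathsf{AS}_{\mathrm{ins}}(\mathit{z}_{77sr},n)=\Omega(\sqrt n)$ and $\mathsf{AS}_{\mathrm{del}}(\mathit{z}_{77sr},n)=\Omega(\sqrt n)$.
   Context: The self-referencing LZ77 factorization of a nonempty string $T$ is $T=f_1\cdots f_z$ defined greedily left to right: for each $i$, with $s=|f_1\cdots f_{i-1}|$, let $u$ be the longest prefix of the remaining suffix $T[s+1..|T|]$ that has an occurrence in $T$ starting at some position in $[1..s]$ (overlaps allowed); if $u$ is the whole remaining suffix then $f_i=u$ is the last factor, otherwise $f_i=uc$ with $c$ the next character. $\mathit{z}_{77sr}(T)=z$. $\mathsf{AS}_{\mathrm{sub}}(C,n)=\sup\{C(T')-C(T):T\in\Sigma^n,T'\in\Sigma^n,\mathsf{ed}(T,T')=1\}$ with $\mathsf{ed}$ the edit distance; $\mathsf{AS}_{\mathrm{ins}}$ the same with $T'\in\Sigma^{n+1}$ and $\mathsf{AS}_{\mathrm{del}}$ with $T'\in\Sigma^{n-1}$. -}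

module Defs where

open import Data.Nat using (ℕ; zero; suc; _+_; _*_; _∸_; _^_; _≤_; _⊔_; _⊓_; _≟_; _<?_)
open import Data.List using (List; []; _∷_; length; drop; map; foldr; upTo)
open import Data.Bool using (Bool; true; false; if_then_else_)
open import Relation.Nullary.Decidable using (does)

-- Strings over an unbounded alphabet (characters are natural numbers),
-- so "as many characters as needed" are available.
Str : Set
Str = List ℕ

ed : Str → Str → ℕ
ed [] ys = length ys
ed (x ∷ xs) [] = length (x ∷ xs)
ed (x ∷ xs) (y ∷ ys) =
  (ed xs ys + (if does (x ≟ y) then 0 else 1))
    ⊓ (suc (ed xs (y ∷ ys)) ⊓ suc (ed (x ∷ xs) ys))

lcp : Str → Str → ℕ
lcp (x ∷ xs) (y ∷ ys) = if does (x ≟ y) then suc (lcp xs ys) else 0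
lcp _ _ = 0

-- (0-indexed) length of the longest prefix of T[s..] that has an occurrence
-- in T starting at some position p < s (overlaps allowed).
longestPrev : Str → ℕ → ℕ
longestPrev T s = foldr _⊔_ 0 (map (λ p → lcp (drop p T) (drop s T)) (upTo s))

-- Greedy self-referencing LZ77 factorization, counting factors from
-- position s; the fuel (≥ remaining length) only ensures termination,
-- each factor has length ≥ 1.
lzCount : Str → ℕ → ℕ → ℕ
lzCount T zero s = 0
lzCount T (suc f) s =
  if does (s <? length T)
  then (let ℓ = longestPrev T s in
        if does (ℓ ≟ (length T ∸ s))
        then 1                              -- u is the whole remaining suffix: last factor
        else suc (lzCount T f (s + suc ℓ)))
  else 0

z77sr : Str → ℕ
z77sr T = lzCount T (length T) 0

-- Fix m ≥ 2 and write Bᵢ = (m−i, …, m−1, m+1, m+1+i). The text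
--   0, 1, …, m−1, m+1, B₁, B₂, …, Bₘ, followed by r fresh characters,
-- has 2m + 1 + r factors: each block Bᵢ is a single factor, because
-- m−i, …, m−1, m+1 is copied from position m−i and m+1+i is new. Replacing the
-- m+1 at position m by m, inserting m before it, or deleting it destroys that
-- source; as m−i occurs only once before Bᵢ, the longest previous factor at Bᵢ
-- now stops after m−i, …, m−1, so every block costs two factors. Thus one edit
-- raises z by m−1, m or m+1 while the length is Θ(m²), and the padding
-- r ≤ m + 3 makes every length n ≥ 10 attainable.

module Submission where

open import Defs
open import Data.Bool using (true; false; if_then_else_)
open import Data.List using (List; []; _∷_; _++_; length; drop; take; foldr)
open import Data.List.Properties using (length-++; ++-assoc; ++-identityʳ; ++-cancelˡ; ∷-injective; length-drop)
open import Data.List.Membership.Propositional using (_∈_)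
open import Data.List.Membership.Propositional.Properties using (∈-map⁺; ∈-upTo⁺; ∈-upTo⁻)
open import Data.List.Relation.Unary.All as All using (All; []; _∷_)
import Data.List.Relation.Unary.All.Properties as All
open import Data.List.Relation.Unary.Any using (here; there)
open import Data.Nat
  using (ℕ; zero; suc; _+_; _*_; _∸_; _^_; _≤_; _<_; _⊔_; _⊓_; _≟_; _<?_; z≤n; s≤s; s≤s⁻¹; z<s)
open import Data.Nat.Properties
open import Data.Nat.Tactic.RingSolver using (solve-∀)
open import Data.Product using (_×_; ∃-syntax; _,_; proj₁; proj₂)
open import Relation.Nullary using (yes; no; does; contradiction)
open import Relation.Nullary.Decidable using (dec-true; dec-false)
open import Relation.Binary.PropositionalEquality

range : ℕ → ℕ → List ℕ
range a zero    = []
range a (suc t) = a ∷ range (suc a) t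

length-range : ∀ a t → length (range a t) ≡ t
length-range a zero    = refl
length-range a (suc t) = cong suc (length-range (suc a) t)

range-++ : ∀ a s t → range a (s + t) ≡ range a s ++ range (a + s) t
range-++ a zero    t = cong (λ b → range b t) (sym (+-identityʳ a))
range-++ a (suc s) t = cong (a ∷_) (trans (range-++ (suc a) s t)
                                          (cong (λ b → range (suc a) s ++ range b t) (sym (+-suc a s))))

range-≥ : ∀ a t → All (a ≤_) (range a t)
range-≥ a zero    = []
range-≥ a (suc t) = ≤-refl ∷ All.map (≤-trans (n≤1+n a)) (range-≥ (suc a) t)

range-< : ∀ {b} a t → a + t ≤ b → All (_< b) (range a t)
range-< a zero    _       = []
range-< a (suc t) a+t<b rewrite +-suc a t = m+n≤o⇒m≤o (suc a) a+t<b ∷ range-< (suc a) t a+t<b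

drop-range-++ : ∀ a t ys → drop t (range a t ++ ys) ≡ ys
drop-range-++ a zero    ys = refl
drop-range-++ a (suc t) ys = drop-range-++ (suc a) t ys

drop-++ˡ : ∀ {A : Set} p (xs ys : List A) → p ≤ length xs → drop p (xs ++ ys) ≡ drop p xs ++ ys
drop-++ˡ zero    xs       ys _        = refl
drop-++ˡ (suc p) (x ∷ xs) ys (s≤s p≤) = drop-++ˡ p xs ys p≤

drop-length-++ : ∀ {A : Set} (xs ys : List A) → drop (length xs) (xs ++ ys) ≡ ys
drop-length-++ []       ys = refl
drop-length-++ (x ∷ xs) ys = drop-length-++ xs ys

∈-++-prefix : ∀ {A : Set} {a : A} ys {zs} u {w} → ys ++ zs ≡ u ++ a ∷ w → length u < length ys → a ∈ ys
∈-++-prefix (y ∷ ys) []      e _        = here (sym (proj₁ (∷-injective e)))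
∈-++-prefix (y ∷ ys) (x ∷ u) e (s≤s lt) = there (∈-++-prefix ys u (proj₂ (∷-injective e)) lt)

-- All P (take 1 xs) says that the first character of xs, if any, satisfies P.

take1-++ : ∀ {P : ℕ → Set} xs ys → All P (take 1 xs) → All P (take 1 ys) → All P (take 1 (xs ++ ys))
take1-++ []      ys _  pys = pys
take1-++ (x ∷ _) ys px _   = px

take1-drop : ∀ {P : ℕ → Set} p xs ys → All P xs → p < length xs → All P (take 1 (drop p xs ++ ys))
take1-drop zero    (x ∷ xs) ys (px ∷ _)  _        = px ∷ []
take1-drop (suc p) (x ∷ xs) ys (_ ∷ pxs) (s≤s p<) = take1-drop p xs ys pxs p<

take1-drop-unique : ∀ {h} α β p ys → All (_≢ h) α → All (_≢ h) β →
                    p < length (α ++ h ∷ β) → p ≢ length α →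
                    All (_≢ h) (take 1 (drop p (α ++ h ∷ β) ++ ys))
take1-drop-unique []      β zero    ys _         _   _        p≢ = contradiction refl p≢
take1-drop-unique []      β (suc p) ys _         β≢h (s≤s p<) _  = take1-drop p β ys β≢h p<
take1-drop-unique (x ∷ α) β zero    ys (x≢h ∷ _) _   _        _  = x≢h ∷ []
take1-drop-unique (x ∷ α) β (suc p) ys (_ ∷ α≢h) β≢h (s≤s p<) p≢ =
  take1-drop-unique α β p ys α≢h β≢h p< (λ p≡ → p≢ (cong suc p≡))

-- Longest previous factors

lcp-≢ : ∀ {x y} xs ys → x ≢ y → lcp (x ∷ xs) (y ∷ ys) ≡ 0
lcp-≢ {x} {y} xs ys x≢y rewrite dec-false (x ≟ y) x≢y = refl

lcp-++ : ∀ u xs ys → lcp (u ++ xs) (u ++ ys) ≡ length u + lcp xs ys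
lcp-++ []      xs ys = refl
lcp-++ (x ∷ u) xs ys rewrite dec-true (x ≟ x) refl = cong suc (lcp-++ u xs ys)

lcp-take1-≢ : ∀ {h} xs ys → All (_≢ h) (take 1 xs) → lcp xs (h ∷ ys) ≡ 0
lcp-take1-≢ []       ys _          = refl
lcp-take1-≢ (x ∷ xs) ys (x≢h ∷ []) = lcp-≢ xs ys x≢h

lcp-take1-≡ : ∀ {x} xs zs ys → take 1 xs ≡ x ∷ [] → 1 ≤ lcp (xs ++ zs) (x ∷ ys)
lcp-take1-≡ (y ∷ xs) zs ys refl rewrite dec-true (y ≟ y) refl = s≤s z≤n

lcp>⇒prefix : ∀ u a w xs → length u < lcp xs (u ++ a ∷ w) → ∃[ w' ] xs ≡ u ++ a ∷ w'
lcp>⇒prefix []      a w (x ∷ xs) lt with x ≟ a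
... | yes refl = xs , refl
... | no x≢a rewrite dec-false (x ≟ a) x≢a with () ← lt
lcp>⇒prefix (y ∷ u) a w (x ∷ xs) lt with x ≟ y
... | yes refl rewrite dec-true (x ≟ x) refl with w' , refl ← lcp>⇒prefix u a w xs (s≤s⁻¹ lt) = w' , refl
... | no x≢y rewrite dec-false (x ≟ y) x≢y with () ← lt

foldr-⊔-upper : ∀ {x xs} → x ∈ xs → x ≤ foldr _⊔_ 0 xs
foldr-⊔-upper              (here refl)  = m≤m⊔n _ _
foldr-⊔-upper {xs = y ∷ _} (there x∈xs) = ≤-trans (foldr-⊔-upper x∈xs) (m≤n⊔m y _)

foldr-⊔-lub : ∀ {L xs} → All (_≤ L) xs → foldr _⊔_ 0 xs ≤ L
foldr-⊔-lub []           = z≤n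
foldr-⊔-lub (x≤L ∷ xs≤L) = ⊔-lub x≤L (foldr-⊔-lub xs≤L)

lcp-shift : ∀ {p} pre rest → p ≤ length pre →
            lcp (drop p (pre ++ rest)) (drop (length pre) (pre ++ rest)) ≡ lcp (drop p pre ++ rest) rest
lcp-shift {p} pre rest p≤ rewrite drop-++ˡ p pre rest p≤ | drop-length-++ pre rest = refl

longestPrev-≥ : ∀ {T pre rest p L} → T ≡ pre ++ rest → p < length pre →
                L ≤ lcp (drop p pre ++ rest) rest → L ≤ longestPrev T (length pre)
longestPrev-≥ {pre = pre} {rest} refl p< L≤ =
  ≤-trans (subst (_ ≤_) (sym (lcp-shift pre rest (<⇒≤ p<))) L≤) (foldr-⊔-upper (∈-map⁺ _ (∈-upTo⁺ p<)))

longestPrev-≤ : ∀ {T pre rest L} → T ≡ pre ++ rest →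
                (∀ p → p < length pre → lcp (drop p pre ++ rest) rest ≤ L) → longestPrev T (length pre) ≤ L
longestPrev-≤ {pre = pre} {rest} refl bound = foldr-⊔-lub (All.map⁺ (All.tabulate λ {p} p∈ →
  subst (_≤ _) (sym (lcp-shift pre rest (<⇒≤ (∈-upTo⁻ p∈)))) (bound p (∈-upTo⁻ p∈))))

longestPrev-fresh : ∀ {T} pre u a w → T ≡ pre ++ u ++ a ∷ w → All (_≢ a) (pre ++ u) →
                    longestPrev T (length pre) ≤ length u
longestPrev-fresh pre u a w T≡ fresh = longestPrev-≤ T≡ bound
  where
  bound : ∀ p → p < length pre → lcp (drop p pre ++ u ++ a ∷ w) (u ++ a ∷ w) ≤ length u
  bound p p< with length u <? lcp (drop p pre ++ u ++ a ∷ w) (u ++ a ∷ w)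
  ... | no u≮lcp = ≮⇒≥ u≮lcp
  ... | yes u<lcp with w' , e ← lcp>⇒prefix u a w _ u<lcp =
    contradiction refl (All.lookup fresh-from-p
      (∈-++-prefix (drop p pre ++ u) u (trans (++-assoc (drop p pre) u _) e) longer))
    where
    fresh-from-p : All (_≢ a) (drop p pre ++ u)
    fresh-from-p = All.++⁺ (All.drop⁺ p (All.++⁻ˡ pre fresh)) (All.++⁻ʳ pre fresh)
    longer : length u < length (drop p pre ++ u)
    longer rewrite length-++ (drop p pre) {u} | length-drop p pre = m<n+m (length u) (m<n⇒0<n∸m p<)

-- Counting factors

Factors : Str → ℕ → ℕ → Set
Factors T s k = ∀ fuel → length T ≤ s + fuel → lzCount T fuel s ≡ k

factors-end : ∀ T → Factors T (length T) 0
factors-end T zero    _ = refl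
factors-end T (suc _) _ rewrite dec-false (length T <? length T) (<-irrefl refl) = refl

factor-step : ∀ {T s L k} → s + suc L ≤ length T → longestPrev T s ≡ L →
              Factors T (s + suc L) k → Factors T s (suc k)
factor-step {T} {s} {L} s+L<T _ _ zero T≤s =
  contradiction (≤-trans s+L<T (subst (length T ≤_) (+-identityʳ s) T≤s)) (m+1+n≰m s)
factor-step {T} {s} {L} {k} s+L<T lp≡L next (suc fuel) T≤s+fuel = one-more-factor
  where
  s<T : s < length T
  s<T = m+n≤o⇒m≤o (suc s) (subst (_≤ length T) (+-suc s L) s+L<T)
  L<T∸s : L < length T ∸ s
  L<T∸s = m+n≤o⇒m≤o∸n (suc L) (subst (_≤ length T) (+-comm s (suc L)) s+L<T)
  enough-fuel : length T ≤ s + suc L + fuel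
  enough-fuel = ≤-trans T≤s+fuel (subst (s + suc fuel ≤_) (sym (+-assoc s (suc L) fuel))
                                        (+-monoʳ-≤ s (s≤s (m≤n+m fuel L))))
  one-more-factor : lzCount T (suc fuel) s ≡ suc k
  one-more-factor rewrite dec-true (s <? length T) s<T | lp≡L | dec-false (L ≟ length T ∸ s) (<⇒≢ L<T∸s) =
    cong suc (next fuel enough-fuel)

factor : ∀ {T} pre u c w {k} → T ≡ pre ++ u ++ c ∷ w → longestPrev T (length pre) ≡ length u →
         Factors T (length (pre ++ u ++ c ∷ [])) k → Factors T (length pre) (suc k)
factor {T} pre u c w {k} T≡ lp≡ next = factor-step within lp≡ (subst (λ s → Factors T s k) end≡ next)
  where
  end≡ : length (pre ++ u ++ c ∷ []) ≡ length pre + suc (length u)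
  end≡ rewrite length-++ pre {u ++ c ∷ []} | length-++ u {c ∷ []} = cong (length pre +_) (+-comm (length u) 1)
  within : length pre + suc (length u) ≤ length T
  within = begin
    length pre + suc (length u)             ≡⟨ end≡ ⟨
    length (pre ++ u ++ c ∷ [])             ≤⟨ m≤m+n _ (length w) ⟩
    length (pre ++ u ++ c ∷ []) + length w  ≡⟨ length-++ (pre ++ u ++ c ∷ []) ⟨
    length ((pre ++ u ++ c ∷ []) ++ w)      ≡⟨ cong length (++-assoc pre _ w) ⟩
    length (pre ++ (u ++ c ∷ []) ++ w)      ≡⟨ cong (λ xs → length (pre ++ xs)) (++-assoc u _ w) ⟩
    length (pre ++ u ++ c ∷ w)              ≡⟨ cong length T≡ ⟨
    length T                                ∎
    where open ≤-Reasoning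

fresh-run : ∀ {T} pre a t w {k} → T ≡ pre ++ range a t ++ w → All (_< a) pre →
            Factors T (length (pre ++ range a t)) k → Factors T (length pre) (t + k)
fresh-run {T} pre a zero    w {k} _  _     next = subst (λ s → Factors T s k) (cong length (++-identityʳ pre)) next
fresh-run {T} pre a (suc t) w {k} T≡ pre<a next = factor pre [] a (range (suc a) t ++ w) T≡ no-match rest
  where
  no-match : longestPrev T (length pre) ≡ 0
  no-match = n≤0⇒n≡0 (longestPrev-fresh pre [] a _ T≡ (All.++⁺ (All.map <⇒≢ pre<a) []))
  rest : Factors T (length (pre ++ a ∷ [])) (t + k)
  rest = fresh-run (pre ++ a ∷ []) (suc a) t w (trans T≡ (sym (++-assoc pre (a ∷ []) _)))
           (All.++⁺ (All.map (λ x<a → ≤-trans x<a (n≤1+n a)) pre<a) (≤-refl ∷ []))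
           (subst (λ xs → Factors T (length xs) k) (sym (++-assoc pre (a ∷ []) _)) next)

-- The construction

block : ℕ → ℕ → List ℕ
block m i = range (m ∸ i) i ++ suc m ∷ suc m + i ∷ []

blocks : ℕ → ℕ → ℕ → List ℕ
blocks m j zero    = []
blocks m j (suc t) = block m (suc j) ++ blocks m (suc j) t

blocks-++ : ∀ m j s t → blocks m j (s + t) ≡ blocks m j s ++ blocks m (j + s) t
blocks-++ m j zero    t = cong (λ k → blocks m k t) (sym (+-identityʳ j))
blocks-++ m j (suc s) t = begin
  block m (suc j) ++ blocks m (suc j) (s + t)
    ≡⟨ cong (block m (suc j) ++_) (blocks-++ m (suc j) s t) ⟩
  block m (suc j) ++ blocks m (suc j) s ++ blocks m (suc j + s) t
    ≡⟨ cong (λ k → block m (suc j) ++ blocks m (suc j) s ++ blocks m k t) (sym (+-suc j s)) ⟩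
  block m (suc j) ++ blocks m (suc j) s ++ blocks m (j + suc s) t
    ≡⟨ ++-assoc (block m (suc j)) _ _ ⟨
  (block m (suc j) ++ blocks m (suc j) s) ++ blocks m (j + suc s) t ∎
  where open ≡-Reasoning

blocks-∷ʳ : ∀ m t → blocks m 0 (suc t) ≡ blocks m 0 t ++ block m (suc t)
blocks-∷ʳ m t = begin
  blocks m 0 (suc t)                    ≡⟨ cong (blocks m 0) (+-comm 1 t) ⟩
  blocks m 0 (t + 1)                    ≡⟨ blocks-++ m 0 t 1 ⟩
  blocks m 0 t ++ block m (suc t) ++ [] ≡⟨ cong (blocks m 0 t ++_) (++-identityʳ (block m (suc t))) ⟩
  blocks m 0 t ++ block m (suc t)       ∎
  where open ≡-Reasoning

block-above : ∀ m i {c} → c ≤ m ∸ i → All (c ≤_) (block m i)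
block-above m i {c} c≤ = All.++⁺ (All.map (≤-trans c≤) (range-≥ (m ∸ i) i))
                                 (c≤1+m ∷ ≤-trans c≤1+m (m≤m+n (suc m) i) ∷ [])
  where
  c≤1+m : c ≤ suc m
  c≤1+m = ≤-trans c≤ (≤-trans (m∸n≤m m i) (n≤1+n m))

block-below : ∀ m i {b} → suc m + suc i ≤ b → All (_< b) (block m i)
block-below m i {b} ≤b =
  All.++⁺ (range-< (m ∸ i) i (≤-trans (+-monoˡ-≤ i (m∸n≤m m i)) (≤-trans (n≤1+n (m + i)) (<⇒≤ 1+m+i<b))))
          (<-≤-trans (m<m+n (suc m) (s≤s z≤n)) ≤b ∷ 1+m+i<b ∷ [])
  where
  1+m+i<b : suc m + i < b
  1+m+i<b = subst (_≤ b) (+-suc (suc m) i) ≤b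

blocks-above : ∀ m j t {c} → c ≤ m ∸ (j + t) → All (c ≤_) (blocks m j t)
blocks-above m j zero    c≤ = []
blocks-above m j (suc t) c≤ rewrite +-suc j t =
  All.++⁺ (block-above m (suc j) (≤-trans c≤ (∸-monoʳ-≤ m (m≤m+n (suc j) t))))
          (blocks-above m (suc j) t c≤)

blocks-below : ∀ m j t {b} → suc m + suc (j + t) ≤ b → All (_< b) (blocks m j t)
blocks-below m j zero    ≤b = []
blocks-below m j (suc t) ≤b rewrite +-suc j t =
  All.++⁺ (block-below m (suc j) (≤-trans (+-monoʳ-≤ (suc m) (s≤s (m≤m+n (suc j) t))) ≤b))
          (blocks-below m (suc j) t ≤b)

-- With i = j + 1, the bounds on Y keep m − i unique and m + 1 + i fresh in front of Bᵢ.
module BlockStep (m j : ℕ) (j<m : j < m) (Y W : List ℕ) {T : Str}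
                 (T≡ : T ≡ range 0 m ++ Y ++ block m (suc j) ++ W)
                 (Y>h : All (m ∸ suc j <_) Y) (Y<a : All (_< suc m + suc j) Y) where

  private
    i h a : ℕ
    i = suc j
    h = m ∸ i
    a = suc m + i

    P R : List ℕ
    P = range 0 m ++ Y
    R = range h i ++ suc m ∷ a ∷ W

    T≡P++R : T ≡ P ++ R
    T≡P++R = trans T≡ (trans (sym (++-assoc (range 0 m) Y _)) (cong (P ++_) (++-assoc (range h i) _ W)))

    T≡P++u++a∷W : T ≡ P ++ (range h i ++ suc m ∷ []) ++ a ∷ W
    T≡P++u++a∷W = trans T≡P++R (cong (P ++_) (sym (++-assoc (range h i) (suc m ∷ []) (a ∷ W))))

    h+i≡m : h + i ≡ m
    h+i≡m = m∸n+n≡m j<m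

    h<m : h < m
    h<m = subst (h <_) h+i≡m (m<m+n h (s≤s z≤n))

    h<P : h < length P
    h<P = ≤-trans h<m (subst (m ≤_) (sym (trans (length-++ (range 0 m)) (cong (_+ length Y) (length-range 0 m))))
                                     (m≤m+n m (length Y)))

    range-split : range 0 m ≡ range 0 h ++ range h i
    range-split = subst (λ n → range 0 n ≡ range 0 h ++ range h i) h+i≡m (range-++ 0 h i)

    P≡α++h∷β : P ≡ range 0 h ++ h ∷ (range (suc h) j ++ Y)
    P≡α++h∷β = trans (cong (_++ Y) range-split) (++-assoc (range 0 h) (range h i) Y)

    drop-h : drop h P ≡ range h i ++ Y
    drop-h = begin
      drop h (range 0 m ++ Y)                 ≡⟨ cong (λ xs → drop h (xs ++ Y)) range-split ⟩
      drop h ((range 0 h ++ range h i) ++ Y)  ≡⟨ cong (drop h) (++-assoc (range 0 h) _ Y) ⟩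
      drop h (range 0 h ++ range h i ++ Y)    ≡⟨ drop-range-++ 0 h _ ⟩
      range h i ++ Y                          ∎
      where open ≡-Reasoning

    lcp-at-h : lcp (drop h P ++ R) R ≡ i + lcp (Y ++ R) (suc m ∷ a ∷ W)
    lcp-at-h = begin
      lcp (drop h P ++ R) R                   ≡⟨ cong (λ xs → lcp (xs ++ R) R) drop-h ⟩
      lcp ((range h i ++ Y) ++ R) R           ≡⟨ cong (λ xs → lcp xs R) (++-assoc (range h i) Y R) ⟩
      lcp (range h i ++ Y ++ R) R             ≡⟨ lcp-++ (range h i) _ _ ⟩
      length (range h i) + lcp (Y ++ R) rest  ≡⟨ cong (_+ lcp (Y ++ R) rest) (length-range h i) ⟩
      i + lcp (Y ++ R) rest                   ∎
      where
      rest : List ℕ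
      rest = suc m ∷ a ∷ W
      open ≡-Reasoning

    lcp-elsewhere : ∀ p → p < length P → p ≢ h → lcp (drop p P ++ R) R ≡ 0
    lcp-elsewhere p p<P p≢h = lcp-take1-≢ (drop p P ++ R) _
      (subst (λ xs → All (_≢ h) (take 1 (drop p xs ++ R))) (sym P≡α++h∷β)
        (take1-drop-unique (range 0 h) _ p R (All.map <⇒≢ (range-< 0 h ≤-refl))
                           (All.map >⇒≢ (All.++⁺ (range-≥ (suc h) j) Y>h))
                           (subst (λ xs → p < length xs) P≡α++h∷β p<P)
                           (λ p≡ → p≢h (trans p≡ (length-range 0 h)))))

    m≤a : m ≤ a
    m≤a = ≤-trans (n≤1+n m) (m≤m+n (suc m) i)

    before-a : All (_< a) (P ++ range h i ++ suc m ∷ [])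
    before-a = All.++⁺ (All.++⁺ (range-< 0 m m≤a) Y<a)
                       (All.++⁺ (range-< h i (subst (_≤ a) (sym h+i≡m) m≤a)) (m<m+n (suc m) (s≤s z≤n) ∷ []))

  -- Bᵢ minus its last character is copied from position m − i.
  nice-block : ∀ {k} → take 1 Y ≡ suc m ∷ [] →
               Factors T (length ((range 0 m ++ Y) ++ block m (suc j))) k →
               Factors T (length (range 0 m ++ Y)) (suc k)
  nice-block {k} Y-starts next =
    factor P u a W T≡P++u++a∷W lp≡
      (subst (λ xs → Factors T (length (P ++ xs)) k) (sym (++-assoc (range h i) (suc m ∷ []) (a ∷ []))) next)
    where
    u : List ℕ
    u = range h i ++ suc m ∷ []
    |u|≡ : length u ≡ i + 1
    |u|≡ = trans (length-++ (range h i)) (cong (_+ 1) (length-range h i))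
    lp≡ : longestPrev T (length P) ≡ length u
    lp≡ = ≤-antisym (longestPrev-fresh P u a W T≡P++u++a∷W (All.map <⇒≢ before-a))
            (longestPrev-≥ T≡P++R h<P (subst₂ _≤_ (sym |u|≡) (sym lcp-at-h)
              (+-monoʳ-≤ i (lcp-take1-≡ Y R (a ∷ W) Y-starts))))

  -- Only the copy from position m − i reaches length i, since m − i occurs nowhere else before Bᵢ.
  damaged-block : ∀ {k} → All (_≢ suc m) (take 1 Y) →
                  Factors T (length ((range 0 m ++ Y) ++ block m (suc j))) k →
                  Factors T (length (range 0 m ++ Y)) (2 + k)
  damaged-block {k} Y-avoids next =
    factor P (range h i) (suc m) (a ∷ W) T≡P++R (trans lp≡i (sym (length-range h i)))
      (factor P' [] a W T≡P'++a∷W a-fresh (subst (λ xs → Factors T (length xs) k) P++block≡ next))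
    where
    P' : List ℕ
    P' = P ++ range h i ++ suc m ∷ []
    T≡P'++a∷W : T ≡ P' ++ a ∷ W
    T≡P'++a∷W = trans T≡P++u++a∷W (sym (++-assoc P _ (a ∷ W)))
    P++block≡ : P ++ block m i ≡ P' ++ a ∷ []
    P++block≡ = trans (cong (P ++_) (sym (++-assoc (range h i) (suc m ∷ []) (a ∷ [])))) (sym (++-assoc P _ (a ∷ [])))
    a-fresh : longestPrev T (length P') ≡ 0
    a-fresh = n≤0⇒n≡0 (longestPrev-fresh P' [] a W T≡P'++a∷W
                (subst (All (_≢ a)) (sym (++-identityʳ P')) (All.map <⇒≢ before-a)))
    bound : ∀ p → p < length P → lcp (drop p P ++ R) R ≤ i
    bound p p<P with p ≟ h
    ... | no p≢h   = subst (_≤ i) (sym (lcp-elsewhere p p<P p≢h)) z≤n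
    ... | yes refl = ≤-reflexive (trans lcp-at-h (trans (cong (i +_) (lcp-take1-≢ (Y ++ R) (a ∷ W) Y++R-avoids))
                                                        (+-identityʳ i)))
      where
      Y++R-avoids : All (_≢ suc m) (take 1 (Y ++ R))
      Y++R-avoids = take1-++ Y R Y-avoids (<⇒≢ (m<n⇒m<1+n h<m) ∷ [])
    lp≡i : longestPrev T (length P) ≡ i
    lp≡i = ≤-antisym (longestPrev-≤ T≡P++R bound)
                     (longestPrev-≥ T≡P++R h<P (subst (i ≤_) (sym lcp-at-h) (m≤m+n i _)))

text : ℕ → ℕ → ℕ → ℕ → Str
text m xa xt r = range 0 m ++ range xa xt ++ blocks m 0 m ++ range (suc m + suc m) r

module Text (m xa xt r : ℕ) (m≤xa : m ≤ xa) (xa+xt≤2+m : xa + xt ≤ suc (suc m)) where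

  T : Str
  T = text m xa xt r

  Y : ℕ → List ℕ
  Y j = range xa xt ++ blocks m 0 j

  Step : ℕ → Set
  Step c = ∀ j t → j + suc t ≡ m → ∀ {k} →
           Factors T (length (range 0 m ++ Y (suc j))) k → Factors T (length (range 0 m ++ Y j)) (c + k)

  private
    pad : List ℕ
    pad = range (suc m + suc m) r

    T≡prefix++suffix : ∀ j t → j + t ≡ m → T ≡ (range 0 m ++ Y j) ++ blocks m j t ++ pad
    T≡prefix++suffix j t e = begin
      range 0 m ++ range xa xt ++ blocks m 0 m ++ pad
        ≡⟨ cong (λ n → range 0 m ++ range xa xt ++ blocks m 0 n ++ pad) (sym e) ⟩
      range 0 m ++ range xa xt ++ blocks m 0 (j + t) ++ pad
        ≡⟨ cong (λ bs → range 0 m ++ range xa xt ++ bs ++ pad) (blocks-++ m 0 j t) ⟩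
      range 0 m ++ range xa xt ++ (blocks m 0 j ++ blocks m j t) ++ pad
        ≡⟨ cong (λ xs → range 0 m ++ range xa xt ++ xs) (++-assoc (blocks m 0 j) _ pad) ⟩
      range 0 m ++ range xa xt ++ blocks m 0 j ++ blocks m j t ++ pad
        ≡⟨ cong (range 0 m ++_) (++-assoc (range xa xt) _ _) ⟨
      range 0 m ++ Y j ++ blocks m j t ++ pad
        ≡⟨ ++-assoc (range 0 m) (Y j) _ ⟨
      (range 0 m ++ Y j) ++ blocks m j t ++ pad ∎
      where open ≡-Reasoning

    T≡-at-block : ∀ j t → j + suc t ≡ m → T ≡ range 0 m ++ Y j ++ block m (suc j) ++ blocks m (suc j) t ++ pad
    T≡-at-block j t e = trans (T≡prefix++suffix j (suc t) e)
      (trans (++-assoc (range 0 m) (Y j) _) (cong (λ xs → range 0 m ++ Y j ++ xs) (++-assoc (block m (suc j)) _ pad)))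

    prefix-∷ʳ : ∀ j → range 0 m ++ Y (suc j) ≡ (range 0 m ++ Y j) ++ block m (suc j)
    prefix-∷ʳ j = begin
      range 0 m ++ range xa xt ++ blocks m 0 (suc j)
        ≡⟨ cong (λ bs → range 0 m ++ range xa xt ++ bs) (blocks-∷ʳ m j) ⟩
      range 0 m ++ range xa xt ++ blocks m 0 j ++ block m (suc j)
        ≡⟨ cong (range 0 m ++_) (++-assoc (range xa xt) _ _) ⟨
      range 0 m ++ Y j ++ block m (suc j)
        ≡⟨ ++-assoc (range 0 m) (Y j) _ ⟨
      (range 0 m ++ Y j) ++ block m (suc j) ∎
      where open ≡-Reasoning

    index<m : ∀ {j t} → j + suc t ≡ m → j < m
    index<m {j} {t} e = subst (suc j ≤_) e (subst (suc j ≤_) (sym (+-suc j t)) (s≤s (m≤m+n j t)))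

    Y-above : ∀ j → j < m → All (m ∸ suc j <_) (Y j)
    Y-above j j<m =
      All.++⁺ (All.map (λ xa≤x → <-≤-trans (∸-monoʳ-< z<s j<m) (≤-trans m≤xa xa≤x)) (range-≥ xa xt))
              (blocks-above m 0 j (∸-monoʳ-< (n<1+n j) j<m))

    Y-below : ∀ j → All (_< suc m + suc j) (Y j)
    Y-below j =
      All.++⁺ (range-< xa xt (≤-trans xa+xt≤2+m (s≤s (subst (suc m ≤_) (sym (+-suc m j)) (s≤s (m≤m+n m j))))))
              (blocks-below m 0 j ≤-refl)

    factors-pad : Factors T (length (range 0 m ++ Y m)) r
    factors-pad = subst (Factors T _) (+-identityʳ r)
      (fresh-run (range 0 m ++ Y m) (suc m + suc m) r []
                 (trans T≡pad (cong ((range 0 m ++ Y m) ++_) (sym (++-identityʳ pad)))) below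
                 (subst (λ xs → Factors T (length xs) 0) T≡pad (factors-end T)))
      where
      T≡pad : T ≡ (range 0 m ++ Y m) ++ pad
      T≡pad = T≡prefix++suffix m 0 (+-identityʳ m)
      below : All (_< suc m + suc m) (range 0 m ++ Y m)
      below = All.++⁺ (range-< 0 m (≤-trans (n≤1+n m) (m≤m+n (suc m) (suc m))))
                      (All.++⁺ (range-< xa xt (≤-trans xa+xt≤2+m (s≤s (m≤n+m (suc m) m))))
                               (blocks-below m 0 m ≤-refl))

    factors-blocks : ∀ {c} → Step c → ∀ t j → j + t ≡ m → Factors T (length (range 0 m ++ Y j)) (t * c + r)
    factors-blocks step zero j e =
      subst (λ n → Factors T (length (range 0 m ++ Y n)) r) (trans (sym e) (+-identityʳ j)) factors-pad
    factors-blocks {c} step (suc t) j e = subst (Factors T _) (sym (+-assoc c (t * c) r))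
      (step j t e (factors-blocks step t (suc j) (trans (sym (+-suc j t)) e)))

    factors-start : ∀ {k} → Factors T (length (range 0 m ++ Y 0)) k → Factors T 0 (m + (xt + k))
    factors-start {k} next = fresh-run [] 0 m _ refl []
      (fresh-run (range 0 m) xa xt _ refl (range-< 0 m m≤xa)
        (subst (λ xs → Factors T (length (range 0 m ++ xs)) k) (++-identityʳ (range xa xt)) next))

  z77sr-text : ∀ {c} → Step c → z77sr T ≡ m + (xt + (m * c + r))
  z77sr-text step = factors-start (factors-blocks step m 0 refl) (length T) ≤-refl

  nice-step : (∀ j → take 1 (Y j) ≡ suc m ∷ []) → Step 1
  nice-step starts j t e {k} next =
    BlockStep.nice-block m j (index<m e) (Y j) _ (T≡-at-block j t e) (Y-above j (index<m e)) (Y-below j)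
      (starts j) (subst (λ xs → Factors T (length xs) k) (prefix-∷ʳ j) next)

  damaged-step : (∀ j → All (_≢ suc m) (take 1 (Y j))) → Step 2
  damaged-step avoids j t e {k} next =
    BlockStep.damaged-block m j (index<m e) (Y j) _ (T≡-at-block j t e) (Y-above j (index<m e)) (Y-below j)
      (avoids j) (subst (λ xs → Factors T (length xs) k) (prefix-∷ʳ j) next)

-- The run at position m is m+1 in the original text and m, (m, m+1) or empty in its three edits.
original substituted inserted deleted : ℕ → ℕ → Str
original    m r = text m (suc m) 1 r
substituted m r = text m m 1 r
inserted    m r = text m m 2 r
deleted     m r = text m m 0 r

z77sr-original : ∀ m r → z77sr (original m r) ≡ m + (1 + (m * 1 + r))
z77sr-original m r = z77sr-text (nice-step (λ _ → refl))
  where open Text m (suc m) 1 r (n≤1+n m) (≤-reflexive (cong suc (+-comm m 1)))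

damaged-start : ∀ m xt j → All (_≢ suc m) (take 1 (range m xt ++ blocks m 0 j))
damaged-start m (suc _) _       = <⇒≢ (n<1+n m) ∷ []
damaged-start m zero    zero    = []
damaged-start m zero    (suc _) = <⇒≢ (s≤s (m∸n≤m m 1)) ∷ []

z77sr-damaged : ∀ m xt r → xt ≤ 2 → z77sr (text m m xt r) ≡ m + (xt + (m * 2 + r))
z77sr-damaged m xt r xt≤2 = z77sr-text (damaged-step (damaged-start m xt))
  where open Text m m xt r ≤-refl (≤-trans (+-monoʳ-≤ m xt≤2) (≤-reflexive (+-comm m 2)))

z77sr-substituted : ∀ m r → z77sr (substituted m r) ≡ m + z77sr (original m r)
z77sr-substituted m r =
  trans (z77sr-damaged m 1 r (s≤s z≤n)) (trans (counts m r) (cong (m +_) (sym (z77sr-original m r))))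
  where
  counts : ∀ m r → m + (1 + (m * 2 + r)) ≡ m + (m + (1 + (m * 1 + r)))
  counts = solve-∀

z77sr-inserted : ∀ m r → z77sr (inserted m r) ≡ suc m + z77sr (original m r)
z77sr-inserted m r =
  trans (z77sr-damaged m 2 r ≤-refl) (trans (counts m r) (cong (suc m +_) (sym (z77sr-original m r))))
  where
  counts : ∀ m r → m + (2 + (m * 2 + r)) ≡ suc m + (m + (1 + (m * 1 + r)))
  counts = solve-∀

z77sr-deleted : ∀ q r → z77sr (deleted (suc q) r) ≡ q + z77sr (original (suc q) r)
z77sr-deleted q r =
  trans (z77sr-damaged (suc q) 0 r z≤n) (trans (counts q r) (cong (q +_) (sym (z77sr-original (suc q) r))))
  where
  counts : ∀ q r → suc q + (0 + (suc q * 2 + r)) ≡ q + (suc q + (1 + (suc q * 1 + r)))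
  counts = solve-∀

-- Lengths

blocksLength : ℕ → ℕ
blocksLength zero    = 0
blocksLength (suc j) = blocksLength j + (suc j + 2)

length-block : ∀ m i → length (block m i) ≡ i + 2
length-block m i = trans (length-++ (range (m ∸ i) i)) (cong (_+ 2) (length-range (m ∸ i) i))

length-blocks : ∀ m j → length (blocks m 0 j) ≡ blocksLength j
length-blocks m zero    = refl
length-blocks m (suc j) = begin
  length (blocks m 0 (suc j))                       ≡⟨ cong length (blocks-∷ʳ m j) ⟩
  length (blocks m 0 j ++ block m (suc j))          ≡⟨ length-++ (blocks m 0 j) ⟩
  length (blocks m 0 j) + length (block m (suc j))  ≡⟨ cong₂ _+_ (length-blocks m j) (length-block m (suc j)) ⟩
  blocksLength j + (suc j + 2)                      ∎
  where open ≡-Reasoning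

length-text : ∀ m xa xt r → length (text m xa xt r) ≡ m + (xt + (blocksLength m + r))
length-text m xa xt r =
  trans (length-++ (range 0 m)) (cong₂ _+_ (length-range 0 m)
  (trans (length-++ (range xa xt)) (cong₂ _+_ (length-range xa xt)
  (trans (length-++ (blocks m 0 m)) (cong₂ _+_ (length-blocks m m) (length-range (suc m + suc m) r))))))

length-inserted : ∀ m r → length (inserted m r) ≡ suc (length (original m r))
length-inserted m r = trans (length-text m m 2 r) (trans (+-suc m _) (cong suc (sym (length-text m (suc m) 1 r))))

length-original : ∀ m r → length (original m r) ≡ suc (length (deleted m r))
length-original m r = trans (length-text m (suc m) 1 r) (trans (+-suc m _) (cong suc (sym (length-text m m 0 r))))

-- Raising r by one, or passing from (m, m + 3) to (m + 1, 0), lengthens the original text by one.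
length-original-covers : ∀ n → ∃[ m ] ∃[ r ] (m + (1 + (blocksLength m + r)) ≡ suc n × r ≤ m + 3)
length-original-covers zero = 0 , 0 , refl , z≤n
length-original-covers (suc n) with m , r , e , r≤ ← length-original-covers n | r <? m + 3
... | yes r< =
  m , suc r , trans (cong (m +_) (cong suc (+-suc (blocksLength m) r))) (trans (+-suc m _) (cong suc e)) , r<
... | no r≮ =
  suc m , 0 , trans (next-m m (blocksLength m)) (cong suc (trans (cong (λ r → m + (1 + (blocksLength m + r))) r≡) e)) ,
  z≤n
  where
  r≡ : m + 3 ≡ r
  r≡ = ≤-antisym (≮⇒≥ r≮) r≤
  next-m : ∀ m b → suc m + (1 + ((b + (suc m + 2)) + 0)) ≡ suc (m + (1 + (b + (m + 3))))
  next-m = solve-∀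

blocksLength-≤ : ∀ m → blocksLength m ≤ m * (m + 2)
blocksLength-≤ zero    = z≤n
blocksLength-≤ (suc m) = ≤-trans (+-monoˡ-≤ (suc m + 2) (blocksLength-≤ m))
                                 (subst (m * (m + 2) + (suc m + 2) ≤_) (sym (step m)) (m≤m+n _ m))
  where
  step : ∀ m → suc m * (suc m + 2) ≡ (m * (m + 2) + (suc m + 2)) + m
  step = solve-∀

length-original-≤ : ∀ m r → r ≤ m + 3 → m + (1 + (blocksLength m + r)) ≤ (m + 2) ^ 2
length-original-≤ m r r≤ =
  ≤-trans (+-monoʳ-≤ m (s≤s (+-mono-≤ (blocksLength-≤ m) r≤))) (≤-reflexive (square m))
  where
  -- (m + 2) ^ 2 unfolds to (m + 2) * ((m + 2) * 1), a form the ring solver accepts.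
  square : ∀ m → m + (1 + (m * (m + 2) + (m + 3))) ≡ (m + 2) * ((m + 2) * 1)
  square = solve-∀

-- Edit distance

ed-++ˡ : ∀ u xs ys → ed (u ++ xs) (u ++ ys) ≤ ed xs ys
ed-++ˡ []      xs ys = ≤-refl
ed-++ˡ (x ∷ u) xs ys rewrite dec-true (x ≟ x) refl | +-identityʳ (ed (u ++ xs) (u ++ ys)) =
  ≤-trans (m⊓n≤m _ _) (ed-++ˡ u xs ys)

ed-refl : ∀ xs → ed xs xs ≡ 0
ed-refl xs = n≤0⇒n≡0 (subst (λ ys → ed ys ys ≤ 0) (++-identityʳ xs) (ed-++ˡ xs [] []))

ed-substitute : ∀ a b w → ed (a ∷ w) (b ∷ w) ≤ 1
ed-substitute a b w rewrite ed-refl w = ≤-trans (m⊓n≤m _ _) (mismatch≤1 (does (a ≟ b)))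
  where
  mismatch≤1 : ∀ β → (if β then 0 else 1) ≤ 1
  mismatch≤1 true  = z≤n
  mismatch≤1 false = ≤-refl

ed-insert : ∀ b w → ed w (b ∷ w) ≤ 1
ed-insert b []      = ≤-refl
ed-insert b (y ∷ w) = ≤-trans (m⊓n≤n _ _) (≤-trans (m⊓n≤n _ _) (s≤s (≤-reflexive (ed-refl (y ∷ w)))))

ed-delete : ∀ a w → ed (a ∷ w) w ≤ 1
ed-delete a []      = ≤-refl
ed-delete a (y ∷ w) = ≤-trans (m⊓n≤n _ _) (≤-trans (m⊓n≤m _ _) (s≤s (≤-reflexive (ed-refl (y ∷ w)))))

ed≡0⇒≡ : ∀ xs ys → ed xs ys ≡ 0 → xs ≡ ys
ed≡0⇒≡ []       []       _ = refl
ed≡0⇒≡ (x ∷ xs) (y ∷ ys) e =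
  cong₂ _∷_ (match (m+n≡0⇒n≡0 (ed xs ys) diagonal≡0)) (ed≡0⇒≡ xs ys (m+n≡0⇒m≡0 (ed xs ys) diagonal≡0))
  where
  first≡0 : ∀ {d} n o → d ⊓ (suc n ⊓ suc o) ≡ 0 → d ≡ 0
  first≡0 {zero} _ _ _ = refl
  diagonal≡0 : ed xs ys + (if does (x ≟ y) then 0 else 1) ≡ 0
  diagonal≡0 = first≡0 (ed xs (y ∷ ys)) (ed (x ∷ xs) ys) e
  match : (if does (x ≟ y) then 0 else 1) ≡ 0 → x ≡ y
  match mismatch≡0 with x ≟ y
  ... | yes x≡y = x≡y
  ... | no x≢y rewrite dec-false (x ≟ y) x≢y with () ← mismatch≡0

ed≡1 : ∀ xs ys → ed xs ys ≤ 1 → xs ≢ ys → ed xs ys ≡ 1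
ed≡1 xs ys ≤1 xs≢ys = ≤-antisym ≤1 (≤∧≢⇒< z≤n (λ 0≡ → xs≢ys (ed≡0⇒≡ xs ys (sym 0≡))))

ed-substituted : ∀ m r → ed (original m r) (substituted m r) ≡ 1
ed-substituted m r = ed≡1 (original m r) (substituted m r)
  (≤-trans (ed-++ˡ (range 0 m) (suc m ∷ rest) (m ∷ rest)) (ed-substitute (suc m) m rest))
  (λ e → 1+n≢n (proj₁ (∷-injective (++-cancelˡ (range 0 m) (suc m ∷ rest) (m ∷ rest) e))))
  where
  rest : Str
  rest = blocks m 0 m ++ range (suc m + suc m) r

ed-inserted : ∀ m r → ed (original m r) (inserted m r) ≡ 1
ed-inserted m r = ed≡1 (original m r) (inserted m r)
  (≤-trans (ed-++ˡ (range 0 m) (suc m ∷ rest) (m ∷ suc m ∷ rest)) (ed-insert m (suc m ∷ rest)))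
  (λ e → 1+n≢n (sym (trans (cong length e) (length-inserted m r))))
  where
  rest : Str
  rest = blocks m 0 m ++ range (suc m + suc m) r

ed-deleted : ∀ m r → ed (original m r) (deleted m r) ≡ 1
ed-deleted m r = ed≡1 (original m r) (deleted m r)
  (≤-trans (ed-++ˡ (range 0 m) (suc m ∷ rest) rest) (ed-delete (suc m) rest))
  (λ e → 1+n≢n (trans (sym (length-original m r)) (cong length e)))
  where
  rest : Str
  rest = blocks m 0 m ++ range (suc m + suc m) r

-- n ≥ 10 forces m ≥ 2, since the original text for m ≤ 1 has length at most (1 + 2)².
original-of-length : ∀ n → 10 ≤ n →
                     ∃[ q ] ∃[ r ] (2 + q + (1 + (blocksLength (2 + q) + r)) ≡ n × n ≤ 16 * suc q ^ 2)
original-of-length (suc n) 10≤ with length-original-covers n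
... | zero , r , e , r≤ =
  contradiction (≤-trans (s≤s (subst (_≤ 4) e (length-original-≤ 0 r r≤))) (m≤m+n 5 5)) (≤⇒≯ 10≤)
... | suc zero , r , e , r≤ =
  contradiction (s≤s (subst (_≤ 9) e (length-original-≤ 1 r r≤))) (≤⇒≯ 10≤)
... | suc (suc q) , r , e , r≤ =
  q , r , e , ≤-trans (subst (_≤ (2 + q + 2) ^ 2) e (length-original-≤ (2 + q) r r≤))
                      (≤-trans (^-monoˡ-≤ 2 4+q≤4*[1+q]) (≤-reflexive (sixteen (suc q))))
  where
  four-times : ∀ q → 4 * suc q ≡ 2 + q + 2 + 3 * q
  four-times = solve-∀
  4+q≤4*[1+q] : 2 + q + 2 ≤ 4 * suc q
  4+q≤4*[1+q] = subst (2 + q + 2 ≤_) (sym (four-times q)) (m≤m+n (2 + q + 2) (3 * q))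
  sixteen : ∀ x → (4 * x) * ((4 * x) * 1) ≡ 16 * (x * (x * 1))
  sixteen = solve-∀

gap-bound : ∀ {n} x y d q → y ≡ d + x → suc q ≤ d → n ≤ 16 * suc q ^ 2 → n ≤ 16 * (y ∸ x) ^ 2
gap-bound x .(d + x) d q refl q<d n≤ rewrite m+n∸n≡m d x = ≤-trans n≤ (*-monoʳ-≤ 16 (^-monoˡ-≤ 2 q<d))

substitution-case : ∀ n → 10 ≤ n → ∃[ T ] ∃[ T' ]
  (length T ≡ n × length T' ≡ n × ed T T' ≡ 1 × n ≤ 16 * ((z77sr T' ∸ z77sr T) ^ 2))
substitution-case n 10≤n with q , r , len≡n , n≤ ← original-of-length n 10≤n =
  original (2 + q) r , substituted (2 + q) r ,
  trans (length-text (2 + q) (3 + q) 1 r) len≡n ,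
  trans (length-text (2 + q) (2 + q) 1 r) len≡n ,
  ed-substituted (2 + q) r ,
  gap-bound (z77sr (original (2 + q) r)) (z77sr (substituted (2 + q) r)) (2 + q) q
            (z77sr-substituted (2 + q) r) (m≤n+m (suc q) 1) n≤

insertion-case : ∀ n → 10 ≤ n → ∃[ T ] ∃[ T' ]
  (length T ≡ n × length T' ≡ suc n × ed T T' ≡ 1 × n ≤ 16 * ((z77sr T' ∸ z77sr T) ^ 2))
insertion-case n 10≤n with q , r , len≡n , n≤ ← original-of-length n 10≤n =
  original (2 + q) r , inserted (2 + q) r ,
  trans (length-text (2 + q) (3 + q) 1 r) len≡n ,
  trans (length-inserted (2 + q) r) (cong suc (trans (length-text (2 + q) (3 + q) 1 r) len≡n)) ,
  ed-inserted (2 + q) r ,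
  gap-bound (z77sr (original (2 + q) r)) (z77sr (inserted (2 + q) r)) (3 + q) q
            (z77sr-inserted (2 + q) r) (m≤n+m (suc q) 2) n≤

deletion-case : ∀ n → 9 ≤ n → ∃[ T ] ∃[ T' ]
  (length T ≡ suc n × length T' ≡ n × ed T T' ≡ 1 × suc n ≤ 16 * ((z77sr T' ∸ z77sr T) ^ 2))
deletion-case n 9≤n with q , r , len≡1+n , 1+n≤ ← original-of-length (suc n) (s≤s 9≤n) =
  original (2 + q) r , deleted (2 + q) r ,
  trans (length-text (2 + q) (3 + q) 1 r) len≡1+n ,
  suc-injective (trans (sym (length-original (2 + q) r)) (trans (length-text (2 + q) (3 + q) 1 r) len≡1+n)) ,
  ed-deleted (2 + q) r ,
  gap-bound (z77sr (original (2 + q) r)) (z77sr (deleted (2 + q) r)) (suc q) q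
            (z77sr-deleted (suc q) r) ≤-refl 1+n≤

theorem16 :
    (∃[ c ] ∃[ n₀ ] ((n : ℕ) → n₀ ≤ n → ∃[ T ] ∃[ T' ]
        (length T ≡ n × length T' ≡ n × ed T T' ≡ 1
          × n ≤ c * ((z77sr T' ∸ z77sr T) ^ 2))))
    × (∃[ c ] ∃[ n₀ ] ((n : ℕ) → n₀ ≤ n → ∃[ T ] ∃[ T' ]
        (length T ≡ n × length T' ≡ suc n × ed T T' ≡ 1
          × n ≤ c * ((z77sr T' ∸ z77sr T) ^ 2))))
    × (∃[ c ] ∃[ n₀ ] ((n : ℕ) → n₀ ≤ n → ∃[ T ] ∃[ T' ]
        (length T ≡ suc n × length T' ≡ n × ed T T' ≡ 1
          × suc n ≤ c * ((z77sr T' ∸ z77sr T) ^ 2))))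
theorem16 = (16 , 10 , substitution-case) , (16 , 10 , insertion-case) , (16 , 9 , deletion-case)
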